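{- Let $\Delta\equiv\lambda x.xx$. The $\lambda$-theory $\mathcal{J}$ axiomatized (over $\beta$-conversion) by the equations $$\Delta\Delta xx = x;\qquad \Delta\Delta xy=\Delta\Delta yx;\qquad \Delta\Delta x(\Delta\Delta yz)=\Delta\Delta(\Delta\Delta xy)z,$$ where $x,y,z$ are variables, is consistent (i.e., it does not equate all $\lambda$-terms).
   Context: A $\lambda$-theory is a congruence on (untyped) $\lambda$-terms, closed under the relevant term-formation rules, that contains $\beta$-conversion; the theory axiomatized by a set of equations is the least such theory containing them. It is consistent if it does not identify all terms. -}

module Defs where

open import Data.Nat using (ℕ; zero; suc)
open import Data.Product using (∃-syntax; _×_)
open import Relation.Nullary using (¬_)

data Term : Set where
  var : ℕ → Term
  app : Term → Term → Term
  lam : Term → Term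

Ren : Set
Ren = ℕ → ℕ

Sub : Set
Sub = ℕ → Term

extR : Ren → Ren
extR ρ zero    = zero
extR ρ (suc n) = suc (ρ n)

rename : Ren → Term → Term
rename ρ (var n)   = var (ρ n)
rename ρ (app M N) = app (rename ρ M) (rename ρ N)
rename ρ (lam M)   = lam (rename (extR ρ) M)

extS : Sub → Sub
extS σ zero    = var zero
extS σ (suc n) = rename suc (σ n)

subst : Sub → Term → Term
subst σ (var n)   = σ n
subst σ (app M N) = app (subst σ M) (subst σ N)
subst σ (lam M)   = lam (subst (extS σ) M)

sub0 : Term → Sub
sub0 N zero    = N
sub0 N (suc n) = var n

_[_] : Term → Term → Term
M [ N ] = subst (sub0 N) M

Δ : Term
Δ = lam (app (var 0) (var 0))

DD : Term → Term → Term
DD M N = app (app (app Δ Δ) M) N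

x y z : Term
x = var 0
y = var 1
z = var 2

data _≈J_ : Term → Term → Set where
  refl  : ∀ {M} → M ≈J M
  sym   : ∀ {M N} → M ≈J N → N ≈J M
  trans : ∀ {M N P} → M ≈J N → N ≈J P → M ≈J P
  appC  : ∀ {M M′ N N′} → M ≈J M′ → N ≈J N′ → app M N ≈J app M′ N′
  lamC  : ∀ {M M′} → M ≈J M′ → lam M ≈J lam M′
  β     : ∀ {M N} → app (lam M) N ≈J (M [ N ])
  ax1   : DD x x ≈J x
  ax2   : DD x y ≈J DD y x
  ax3   : DD x (DD y z) ≈J DD (DD x y) z

Consistent : (Term → Term → Set) → Set
Consistent _≈_ = ∃[ M ] ∃[ N ] ¬ (M ≈ N)

-- J has a graph model in the style of Engeler's.  Besides the ordinary arrows
-- bs ↦ e, the codes contain, for every arrow bs ↦ (cs ↦ e) with e ∈ bs ++ cs,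
-- a "joiner" that decodes to the arrow from the singleton {itself} to it.  The
-- joiners make Δ self-applicable, and ΔΔ then denotes exactly the set of these
-- join arrows, so that ΔΔ M N denotes ⟦M⟧ ∪ ⟦N⟧: the three axioms become
-- idempotence, commutativity and associativity of union.  The model validates β
-- because the denotation of a term is continuous in its environment, and it
-- separates the variables x and y.
module Submission where

open import Data.List using (List; []; _∷_; _++_)
open import Data.List.Membership.Propositional using (_∈_)
open import Data.List.Membership.Propositional.Properties using (∈-++⁺ˡ; ∈-++⁺ʳ; ∈-++⁻)
open import Data.List.Relation.Unary.All as All using (All; []; _∷_)
open import Data.List.Relation.Unary.Any using (here; there)
open import Data.Nat using (ℕ; zero; suc)
open import Data.Product using (∃-syntax; _×_; _,_; proj₁; proj₂)
open import Data.Sum using (_⊎_; inj₁; inj₂; [_,_])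
open import Function using (_∘_; id)
open import Level using (0ℓ)
open import Relation.Binary.PropositionalEquality using (_≡_; refl)
import Relation.Binary.Reasoning.Setoid as SetoidReasoning
open import Relation.Unary using (Pred; _⊆_; _≐_; _∪_; U; ∅)
open import Relation.Unary.Algebra using (∪-cong; ∪-comm; ∪-assoc; ∪-idem)
open import Relation.Unary.Properties using (≐-refl; ≐-sym; ≐-trans)
open import Relation.Unary.Relation.Binary.Equality using (≐-setoid)

open import Defs

data Code : Set where
  atom   : Code
  arrow  : List Code → Code → Code
  joiner : (bs cs : List Code) (e : Code) → e ∈ bs ⊎ e ∈ cs → Code

data Decodes : Code → List Code → Code → Set where
  arrowᵈ  : ∀ {bs e} → Decodes (arrow bs e) bs e
  joinerᵈ : ∀ {bs cs e} {p : e ∈ bs ⊎ e ∈ cs} →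
            Decodes (joiner bs cs e p) (joiner bs cs e p ∷ []) (arrow bs (arrow cs e))

Decodes-functional : ∀ {c bs bs′ e e′} →
                     Decodes c bs e → Decodes c bs′ e′ → bs ≡ bs′ × e ≡ e′
Decodes-functional arrowᵈ  arrowᵈ  = refl , refl
Decodes-functional joinerᵈ joinerᵈ = refl , refl

Val : Set₁
Val = Pred Code 0ℓ

Env : Set₁
Env = ℕ → Val

private
  variable
    a a′ f f′ : Val
    ρ ρ′ : Env
    F G : List Code → Val

mem : List Code → Val
mem bs c = c ∈ bs

_·_ : Val → Val → Val
(f · a) e = ∃[ c ] ∃[ bs ] f c × Decodes c bs e × All a bs

Λ : (List Code → Val) → Val
Λ F c = ∃[ bs ] ∃[ e ] Decodes c bs e × F bs e

_▸_ : Val → Env → Env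
(a ▸ ρ) zero    = a
(a ▸ ρ) (suc n) = ρ n

⟦_⟧ : Term → Env → Val
⟦ var n ⟧   ρ = ρ n
⟦ app M N ⟧ ρ = ⟦ M ⟧ ρ · ⟦ N ⟧ ρ
⟦ lam M ⟧   ρ = Λ λ bs → ⟦ M ⟧ (mem bs ▸ ρ)

_⊑_ : Env → Env → Set
ρ ⊑ ρ′ = ∀ n → ρ n ⊆ ρ′ n

_≋_ : Env → Env → Set
ρ ≋ ρ′ = ∀ n → ρ n ≐ ρ′ n

·-mono : f ⊆ f′ → a ⊆ a′ → f · a ⊆ f′ · a′
·-mono f⊆f′ a⊆a′ (c , bs , fc , d , abs) = c , bs , f⊆f′ fc , d , All.map a⊆a′ abs

·-cong : f ≐ f′ → a ≐ a′ → f · a ≐ f′ · a′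
·-cong (f⊆f′ , f′⊆f) (a⊆a′ , a′⊆a) = ·-mono f⊆f′ a⊆a′ , ·-mono f′⊆f a′⊆a

Λ-mono : (∀ bs → F bs ⊆ G bs) → Λ F ⊆ Λ G
Λ-mono F⊆G (bs , e , d , Fe) = bs , e , d , F⊆G bs Fe

Λ-cong : (∀ bs → F bs ≐ G bs) → Λ F ≐ Λ G
Λ-cong F≐G = Λ-mono (proj₁ ∘ F≐G) , Λ-mono (proj₂ ∘ F≐G)

▸-mono : a ⊆ a′ → ρ ⊑ ρ′ → (a ▸ ρ) ⊑ (a′ ▸ ρ′)
▸-mono a⊆a′ ρ⊑ρ′ zero    = a⊆a′
▸-mono a⊆a′ ρ⊑ρ′ (suc n) = ρ⊑ρ′ n

⟦⟧-mono : ∀ M → ρ ⊑ ρ′ → ⟦ M ⟧ ρ ⊆ ⟦ M ⟧ ρ′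
⟦⟧-mono (var n)   ρ⊑ρ′ = ρ⊑ρ′ n
⟦⟧-mono (app M N) ρ⊑ρ′ = ·-mono (⟦⟧-mono M ρ⊑ρ′) (⟦⟧-mono N ρ⊑ρ′)
⟦⟧-mono (lam M)   ρ⊑ρ′ = Λ-mono λ _ → ⟦⟧-mono M (▸-mono id ρ⊑ρ′)

extR-▸ : ∀ {r} → (ρ ∘ r) ≋ ρ′ → ((a ▸ ρ) ∘ extR r) ≋ (a ▸ ρ′)
extR-▸ h zero    = ≐-refl
extR-▸ h (suc n) = h n

⟦⟧-rename : ∀ M {r} → (ρ ∘ r) ≋ ρ′ → ⟦ rename r M ⟧ ρ ≐ ⟦ M ⟧ ρ′
⟦⟧-rename (var n)   h = h n
⟦⟧-rename (app M N) h = ·-cong (⟦⟧-rename M h) (⟦⟧-rename N h)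
⟦⟧-rename (lam M)   h = Λ-cong λ _ → ⟦⟧-rename M (extR-▸ h)

⟦⟧-weaken : ∀ M → ⟦ rename suc M ⟧ (a ▸ ρ) ≐ ⟦ M ⟧ ρ
⟦⟧-weaken M = ⟦⟧-rename M λ _ → ≐-refl

extS-▸ : ∀ {σ} → (λ n → ⟦ σ n ⟧ ρ) ≋ ρ′ → (λ n → ⟦ extS σ n ⟧ (a ▸ ρ)) ≋ (a ▸ ρ′)
extS-▸         h zero    = ≐-refl
extS-▸ {σ = σ} h (suc n) = ≐-trans (⟦⟧-weaken (σ n)) (h n)

⟦⟧-subst : ∀ M {σ} → (λ n → ⟦ σ n ⟧ ρ) ≋ ρ′ → ⟦ subst σ M ⟧ ρ ≐ ⟦ M ⟧ ρ′
⟦⟧-subst (var n)   h = h n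
⟦⟧-subst (app M N) h = ·-cong (⟦⟧-subst M h) (⟦⟧-subst N h)
⟦⟧-subst (lam M)   h = Λ-cong λ _ → ⟦⟧-subst M (extS-▸ h)

⟦⟧-sub0 : ∀ M N → ⟦ M [ N ] ⟧ ρ ≐ ⟦ M ⟧ (⟦ N ⟧ ρ ▸ ρ)
⟦⟧-sub0 M N = ⟦⟧-subst M λ { zero → ≐-refl ; (suc n) → ≐-refl }

FinEnv : Set
FinEnv = ℕ → List Code

⟪_⟫ : FinEnv → Env
⟪ φ ⟫ n = mem (φ n)

_∪ᶠ_ : FinEnv → FinEnv → FinEnv
(φ ∪ᶠ ψ) n = φ n ++ ψ n

⊑-∪ᶠˡ : ∀ {φ ψ} → ⟪ φ ⟫ ⊑ ⟪ φ ∪ᶠ ψ ⟫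
⊑-∪ᶠˡ n = ∈-++⁺ˡ

⊑-∪ᶠʳ : ∀ φ {ψ} → ⟪ ψ ⟫ ⊑ ⟪ φ ∪ᶠ ψ ⟫
⊑-∪ᶠʳ φ n = ∈-++⁺ʳ (φ n)

∪ᶠ-⊑ : ∀ {φ ψ} → ⟪ φ ⟫ ⊑ ρ → ⟪ ψ ⟫ ⊑ ρ → ⟪ φ ∪ᶠ ψ ⟫ ⊑ ρ
∪ᶠ-⊑ {φ = φ} φ⊑ρ ψ⊑ρ n c∈ = [ φ⊑ρ n , ψ⊑ρ n ] (∈-++⁻ (φ n) c∈)

singleᶠ : ℕ → Code → FinEnv
singleᶠ zero    e zero    = e ∷ []
singleᶠ zero    e (suc m) = []
singleᶠ (suc n) e zero    = []
singleᶠ (suc n) e (suc m) = singleᶠ n e m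

singleᶠ-∈ : ∀ n e → e ∈ singleᶠ n e n
singleᶠ-∈ zero    e = here refl
singleᶠ-∈ (suc n) e = singleᶠ-∈ n e

singleᶠ-⊑ : ∀ n {e} → ρ n e → ⟪ singleᶠ n e ⟫ ⊑ ρ
singleᶠ-⊑ zero    ρe zero    (here refl) = ρe
singleᶠ-⊑ (suc n) ρe (suc m) c∈          = singleᶠ-⊑ n ρe m c∈

FinApprox : Term → Env → Val
FinApprox M ρ e = ∃[ φ ] ⟪ φ ⟫ ⊑ ρ × ⟦ M ⟧ ⟪ φ ⟫ e

finApprox-All : ∀ N {bs} → ⟦ N ⟧ ρ ⊆ FinApprox N ρ → All (⟦ N ⟧ ρ) bs →
                ∃[ φ ] ⟪ φ ⟫ ⊑ ρ × All (⟦ N ⟧ ⟪ φ ⟫) bs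
finApprox-All N approx [] = (λ _ → []) , (λ _ ()) , []
finApprox-All N approx (Nc ∷ Nbs) with approx Nc | finApprox-All N approx Nbs
... | φ , φ⊑ρ , Nc′ | ψ , ψ⊑ρ , Nbs′ =
  φ ∪ᶠ ψ , ∪ᶠ-⊑ φ⊑ρ ψ⊑ρ , ⟦⟧-mono N ⊑-∪ᶠˡ Nc′ ∷ All.map (⟦⟧-mono N (⊑-∪ᶠʳ φ)) Nbs′

⟦⟧-continuous : ∀ M → ⟦ M ⟧ ρ ⊆ FinApprox M ρ
⟦⟧-continuous (var n) {e} ρe = singleᶠ n e , singleᶠ-⊑ n ρe , singleᶠ-∈ n e
⟦⟧-continuous (app M N) (c , bs , Mc , d , Nbs)
  with ⟦⟧-continuous M Mc | finApprox-All N (⟦⟧-continuous N) Nbs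
... | φ , φ⊑ρ , Mc′ | ψ , ψ⊑ρ , Nbs′ =
  φ ∪ᶠ ψ , ∪ᶠ-⊑ φ⊑ρ ψ⊑ρ ,
  c , bs , ⟦⟧-mono M ⊑-∪ᶠˡ Mc′ , d , All.map (⟦⟧-mono N (⊑-∪ᶠʳ φ)) Nbs′
⟦⟧-continuous (lam M) (bs , e , d , Me) with ⟦⟧-continuous M Me
... | φ , φ⊑ , Me′ = φ ∘ suc , φ⊑ ∘ suc , bs , e , d , ⟦⟧-mono M unshift Me′
  where
  unshift : ⟪ φ ⟫ ⊑ (mem bs ▸ ⟪ φ ∘ suc ⟫)
  unshift zero    = φ⊑ zero
  unshift (suc n) = id

⟦⟧-β : ∀ M N → ⟦ app (lam M) N ⟧ ρ ≐ ⟦ M ⟧ (⟦ N ⟧ ρ ▸ ρ)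
⟦⟧-β {ρ} M N = contract , expand
  where
  contract : ⟦ app (lam M) N ⟧ ρ ⊆ ⟦ M ⟧ (⟦ N ⟧ ρ ▸ ρ)
  contract (c , bs , (bs′ , e′ , d′ , Me′) , d , Nbs) with Decodes-functional d′ d
  ... | refl , refl = ⟦⟧-mono M (▸-mono (All.lookup Nbs) λ _ → id) Me′

  expand : ⟦ M ⟧ (⟦ N ⟧ ρ ▸ ρ) ⊆ ⟦ app (lam M) N ⟧ ρ
  expand {e} Me with ⟦⟧-continuous M Me
  ... | φ , φ⊑ , Me′ =
    arrow (φ 0) e , φ 0 , (φ 0 , e , arrowᵈ , ⟦⟧-mono M shrink Me′) , arrowᵈ , All.tabulate (φ⊑ 0)
    where
    shrink : ⟪ φ ⟫ ⊑ (mem (φ 0) ▸ ρ)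
    shrink zero    = id
    shrink (suc n) = φ⊑ (suc n)

data JoinArrow : Val where
  joinArrow : ∀ {bs cs e} → e ∈ bs ⊎ e ∈ cs → JoinArrow (arrow bs (arrow cs e))

selfApp : Val
selfApp = Λ λ bs → mem bs · mem bs

selfApp-joiner : ∀ {bs cs e} (p : e ∈ bs ⊎ e ∈ cs) → selfApp (joiner bs cs e p)
selfApp-joiner p = _ , _ , joinerᵈ , joiner _ _ _ p , _ , here refl , joinerᵈ , here refl ∷ []

-- An arrow γ ↦ e in selfApp has e ∈ γ · γ, so it is justified by a structurally
-- smaller code taken from γ, whose arguments again lie in γ.
mutual
  selfApp-decodes-join : ∀ c {bs e} → selfApp c → Decodes c bs e → All selfApp bs → JoinArrow e
  selfApp-decodes-join (joiner _ _ _ p) _ joinerᵈ _ = joinArrow p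
  selfApp-decodes-join (arrow γ e) (_ , _ , arrowᵈ , c′ , γ′ , c′∈γ , d′ , γ′⊆γ) arrowᵈ sγ =
    selfApp-decodes-join-∈ γ c′∈γ sγ d′ (All.map (All.lookup sγ) γ′⊆γ)

  selfApp-decodes-join-∈ : ∀ γ {c bs e} → c ∈ γ → All selfApp γ →
                           Decodes c bs e → All selfApp bs → JoinArrow e
  selfApp-decodes-join-∈ (c ∷ _) (here refl) (sc ∷ _)  = selfApp-decodes-join c sc
  selfApp-decodes-join-∈ (_ ∷ γ) (there c∈γ) (_ ∷ sγ) = selfApp-decodes-join-∈ γ c∈γ sγ

selfApp-·-selfApp : selfApp · selfApp ≐ JoinArrow
selfApp-·-selfApp = (λ (c , _ , sc , d , sbs) → selfApp-decodes-join c sc d sbs)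
                  , λ { (joinArrow p) → _ , _ , selfApp-joiner p , joinerᵈ , selfApp-joiner p ∷ [] }

JoinArrow-· : (JoinArrow · a) · a′ ≐ a ∪ a′
JoinArrow-· {a} {a′} = split , join
  where
  split : (JoinArrow · a) · a′ ⊆ a ∪ a′
  split (_ , _ , (_ , _ , joinArrow p , arrowᵈ , abs) , arrowᵈ , a′cs) =
    [ inj₁ ∘ All.lookup abs , inj₂ ∘ All.lookup a′cs ] p

  join : a ∪ a′ ⊆ (JoinArrow · a) · a′
  join {e} (inj₁ ae)  =
    arrow [] e , [] , (_ , _ , joinArrow (inj₁ (here refl)) , arrowᵈ , ae ∷ []) , arrowᵈ , []
  join {e} (inj₂ a′e) =
    arrow (e ∷ []) e , _ , (_ , [] , joinArrow (inj₂ (here refl)) , arrowᵈ , []) , arrowᵈ , a′e ∷ []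

⟦DD⟧ : ∀ M N ρ → ⟦ DD M N ⟧ ρ ≐ ⟦ M ⟧ ρ ∪ ⟦ N ⟧ ρ
⟦DD⟧ M N ρ = ≐-trans (·-cong (·-cong selfApp-·-selfApp ≐-refl) ≐-refl) JoinArrow-·

⟦⟧-sound : ∀ {M N} → M ≈J N → ∀ ρ → ⟦ M ⟧ ρ ≐ ⟦ N ⟧ ρ
⟦⟧-sound refl        ρ = ≐-refl
⟦⟧-sound (sym p)     ρ = ≐-sym (⟦⟧-sound p ρ)
⟦⟧-sound (trans p q) ρ = ≐-trans (⟦⟧-sound p ρ) (⟦⟧-sound q ρ)
⟦⟧-sound (appC p q)  ρ = ·-cong (⟦⟧-sound p ρ) (⟦⟧-sound q ρ)
⟦⟧-sound (lamC p)    ρ = Λ-cong λ bs → ⟦⟧-sound p (mem bs ▸ ρ)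
⟦⟧-sound (β {M} {N}) ρ = ≐-trans (⟦⟧-β M N) (≐-sym (⟦⟧-sub0 M N))
⟦⟧-sound ax1         ρ = ≐-trans (⟦DD⟧ x x ρ) (∪-idem (ρ 0))
⟦⟧-sound ax2         ρ = begin
  ⟦ DD x y ⟧ ρ  ≈⟨ ⟦DD⟧ x y ρ ⟩
  ρ 0 ∪ ρ 1     ≈⟨ ∪-comm (ρ 0) (ρ 1) ⟩
  ρ 1 ∪ ρ 0     ≈⟨ ⟦DD⟧ y x ρ ⟨
  ⟦ DD y x ⟧ ρ  ∎
  where open SetoidReasoning (≐-setoid Code 0ℓ)
⟦⟧-sound ax3         ρ = begin
  ⟦ DD x (DD y z) ⟧ ρ    ≈⟨ ⟦DD⟧ x (DD y z) ρ ⟩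
  ρ 0 ∪ ⟦ DD y z ⟧ ρ     ≈⟨ ∪-cong ≐-refl (⟦DD⟧ y z ρ) ⟩
  ρ 0 ∪ (ρ 1 ∪ ρ 2)      ≈⟨ ∪-assoc (ρ 0) (ρ 1) (ρ 2) ⟨
  (ρ 0 ∪ ρ 1) ∪ ρ 2      ≈⟨ ∪-cong (⟦DD⟧ x y ρ) ≐-refl ⟨
  ⟦ DD x y ⟧ ρ ∪ ρ 2     ≈⟨ ⟦DD⟧ (DD x y) z ρ ⟨
  ⟦ DD (DD x y) z ⟧ ρ    ∎
  where open SetoidReasoning (≐-setoid Code 0ℓ)

theorem4p2 : Consistent _≈J_
theorem4p2 = x , y , λ x≈y → proj₁ (⟦⟧-sound x≈y separating) {atom} _
  where
  separating : Env
  separating zero    = U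
  separating (suc n) = ∅
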